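{- Let $m,n$ be positive integers and let $z=(z_1,\ldots,z_m)\in\mathbb{R}^m$ have pairwise distinct nonzero entries. Let $\phi_z:\mathbb{R}^{m\times n}\to\mathbb{R}^n$, $\phi_z(X)=zX$. Then $\phi_z(\textit{PPerm}(m,n))=\mathcal{P}_z(n,m)$.
   Context: $\textit{PPerm}(m,n)\subseteq\mathbb{R}^{m\times n}$ is the convex hull of all $m\times n$ partial permutation matrices (matrices with entries in $\{0,1\}$ with every row sum and column sum in $\{0,1\}$). $\mathcal{P}_z(n,m)\subseteq\mathbb{R}^n$ is the convex hull of all words of length $n$ with entries in $\{0,z_1,\ldots,z_m\}$ whose nonzero entries are pairwise distinct. -}

module Defs where

open import Level using (Level; _⊔_; suc)
open import Algebra.Bundles using (CommutativeRing)
open import Relation.Binary.Core using (Rel)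
open import Relation.Binary.Structures using (IsTotalOrder)
open import Relation.Nullary using (¬_)
open import Relation.Binary.PropositionalEquality using (_≡_; _≢_)
open import Data.Nat using (ℕ)
open import Data.Fin using (Fin)
open import Data.Product using (Σ; ∃; _×_; _,_)
open import Data.Sum using (_⊎_)

-- An ordered field (the standard axioms), stated over a setoid-based
-- commutative ring.  ℝ is an instance; agda-stdlib has no real numbers.
record OrderedField (c ℓ₁ ℓ₂ : Level) : Set (Level.suc (c ⊔ ℓ₁ ⊔ ℓ₂)) where
  field
    commutativeRing : CommutativeRing c ℓ₁
  open CommutativeRing commutativeRing public
  field
    _≤_          : Rel Carrier ℓ₂
    isTotalOrder : IsTotalOrder _≈_ _≤_
    0≉1          : ¬ (0# ≈ 1#)
    inverse      : ∀ x → ¬ (x ≈ 0#) → Σ Carrier (λ y → x * y ≈ 1#)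
    +-mono-≤     : ∀ {x y} z → x ≤ y → (x + z) ≤ (y + z)
    *-nonneg     : ∀ {x y} → 0# ≤ x → 0# ≤ y → 0# ≤ (x * y)

module Poly {c ℓ₁ ℓ₂ : Level} (F : OrderedField c ℓ₁ ℓ₂) where
  open OrderedField F
  open import Algebra.Properties.CommutativeMonoid.Sum +-commutativeMonoid
    using (sum)

  ∑ : ∀ {k} → (Fin k → Carrier) → Carrier
  ∑ = sum

  conv : ∀ {p} {I : Set} → ((I → Carrier) → Set p) → (I → Carrier) → Set (c ⊔ ℓ₁ ⊔ ℓ₂ ⊔ p)
  conv {I = I} S x =
    Σ ℕ λ k → Σ (Fin k → (I → Carrier)) λ pts → Σ (Fin k → Carrier) λ w →
      (∀ t → S (pts t)) × (∀ t → 0# ≤ w t) × (∑ w ≈ 1#)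
      × (∀ i → x i ≈ ∑ (λ t → w t * pts t i))

  Matrix : ℕ → ℕ → Set c
  Matrix m n = Fin m × Fin n → Carrier

  rowSum : ∀ {m n} → Matrix m n → Fin m → Carrier
  rowSum X i = ∑ (λ j → X (i , j))

  colSum : ∀ {m n} → Matrix m n → Fin n → Carrier
  colSum X j = ∑ (λ i → X (i , j))

  IsPartialPerm : ∀ {m n} → Matrix m n → Set ℓ₁
  IsPartialPerm X =
    (∀ ij → X ij ≈ 0# ⊎ X ij ≈ 1#)
    × (∀ i → rowSum X i ≈ 0# ⊎ rowSum X i ≈ 1#)
    × (∀ j → colSum X j ≈ 0# ⊎ colSum X j ≈ 1#)

  PPerm : (m n : ℕ) → Matrix m n → Set (c ⊔ ℓ₁ ⊔ ℓ₂)
  PPerm m n = conv IsPartialPerm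

  IsWord : ∀ {m} (n : ℕ) → (Fin m → Carrier) → (Fin n → Carrier) → Set ℓ₁
  IsWord {m} n z w =
    (∀ j → w j ≈ 0# ⊎ Σ (Fin m) (λ i → w j ≈ z i))
    × (∀ j k → j ≢ k → ¬ (w j ≈ 0#) → ¬ (w j ≈ w k))

  𝒫 : ∀ {m} → (Fin m → Carrier) → (n : ℕ) → (Fin n → Carrier) → Set (c ⊔ ℓ₁ ⊔ ℓ₂)
  𝒫 z n = conv (IsWord n z)

  φ : ∀ {m n} → (Fin m → Carrier) → Matrix m n → Fin n → Carrier
  φ z X j = ∑ (λ i → z i * X (i , j))

  Image : ∀ {m n p} → (Fin m → Carrier) → (Matrix m n → Set p) → (Fin n → Carrier) → Set (c ⊔ ℓ₁ ⊔ p)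
  Image {m} {n} z S y = Σ (Matrix m n) λ X → S X × (∀ j → y j ≈ φ z X j)

-- φ_z is linear, so it sends a convex combination of matrices to the convex
-- combination of their images with the same weights; it therefore suffices
-- that φ_z maps partial permutation matrices onto words.  A column of a
-- partial permutation matrix is zero or a unit vector e_i, so its image is 0
-- or z_i, and two equal nonzero letters would (z being injective) put two
-- ones in one row.  Conversely a word is the image of the matrix whose j-th
-- column is e_i if the j-th letter is z_i and zero if it is 0; distinct
-- nonzero letters and z_i ≠ 0 leave at most one 1 in every row.  The order
-- enters only through the fact that a 0/1 family sums to 0 or 1 exactly when
-- it contains at most one 1, because 1 + 1 + e ≥ 2 for e ≥ 0.
module Submission where

open import Defs
open import Data.Nat using (ℕ; _≤_)
import Data.Nat as ℕ
open import Data.Fin using (Fin; zero; suc; _≟_; punchIn)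
open import Data.Fin.Properties using (suc-injective; punchInᵢ≢i)
open import Data.Product using (Σ; _×_; _,_; proj₁; proj₂)
open import Data.Sum using (_⊎_; inj₁; inj₂)
import Data.Sum as Sum
open import Data.Empty using (⊥-elim)
open import Function using (_∘_)
open import Level using (_⊔_)
open import Relation.Nullary using (¬_; yes; no)
open import Relation.Binary.PropositionalEquality using (_≡_; _≢_)
import Relation.Binary.PropositionalEquality as ≡
open import Relation.Binary.Structures using (IsTotalOrder)
import Algebra.Properties.Ring as RingProperties
import Algebra.Properties.Group as GroupProperties
import Algebra.Properties.Semiring.Sum as SemiringSum
import Relation.Binary.Reasoning.Setoid as SetoidReasoning

module PartialPermutations {c ℓ₁ ℓ₂} (F : OrderedField c ℓ₁ ℓ₂) where
  open OrderedField F hiding (zero) renaming (_≤_ to infix 4 _≤F_)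
  open Poly F
  open SemiringSum semiring
    using (sum-cong-≋; sum-replicate-zero; sum-remove; ∑-comm; *-distribˡ-sum)
  open RingProperties ring using (-1*x≈-x; -‿involutive)
  open GroupProperties +-group using (identityʳ-unique)
  open SetoidReasoning setoid
  private module ≤ = IsTotalOrder isTotalOrder

  0≤1 : 0# ≤F 1#
  0≤1 with ≤.total 0# 1#
  ... | inj₁ 0≤1 = 0≤1
  ... | inj₂ 1≤0 = ≤.≤-respʳ-≈ -1*-1≈1 (*-nonneg 0≤-1 0≤-1)
    where
    0≤-1 : 0# ≤F - 1#
    0≤-1 = ≤.≤-respˡ-≈ (-‿inverseʳ 1#)
             (≤.≤-respʳ-≈ (+-identityˡ (- 1#)) (+-mono-≤ (- 1#) 1≤0))
    -1*-1≈1 : - 1# * - 1# ≈ 1#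
    -1*-1≈1 = trans (-1*x≈-x (- 1#)) (-‿involutive 1#)

  +-nonneg : ∀ {x y} → 0# ≤F x → 0# ≤F y → 0# ≤F x + y
  +-nonneg {x} {y} 0≤x 0≤y =
    ≤.trans 0≤y (≤.≤-respˡ-≈ (+-identityˡ y) (+-mono-≤ y 0≤x))

  1+x≉0 : ∀ {x} → 0# ≤F x → ¬ (1# + x ≈ 0#)
  1+x≉0 {x} 0≤x 1+x≈0 = 0≉1 (≤.antisym 0≤1 1≤0)
    where
    1≤0 : 1# ≤F 0#
    1≤0 = ≤.≤-respˡ-≈ (+-identityˡ 1#)
            (≤.≤-respʳ-≈ (trans (+-comm x 1#) 1+x≈0) (+-mono-≤ 1# 0≤x))

  2+x∉01 : ∀ {x} → 0# ≤F x → ¬ (1# + (1# + x) ≈ 0# ⊎ 1# + (1# + x) ≈ 1#)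
  2+x∉01 0≤x (inj₁ 2+x≈0) = 1+x≉0 (+-nonneg 0≤1 0≤x) 2+x≈0
  2+x∉01 0≤x (inj₂ 2+x≈1) = 1+x≉0 0≤x (identityʳ-unique 1# _ 2+x≈1)

  ∑-zeros : ∀ {k} {g : Fin k → Carrier} → (∀ i → g i ≈ 0#) → ∑ g ≈ 0#
  ∑-zeros {k} g≈0 = trans (sum-cong-≋ g≈0) (sum-replicate-zero k)

  ∑-single : ∀ {k} {g : Fin k → Carrier} i₀ → (∀ i → i ≢ i₀ → g i ≈ 0#) → ∑ g ≈ g i₀
  ∑-single {ℕ.suc _} {g} i₀ g≈0 = begin
    ∑ g                            ≈⟨ sum-remove g ⟩
    g i₀ + ∑ (g ∘ punchIn i₀)      ≈⟨ +-congˡ (∑-zeros (λ i → g≈0 _ (punchInᵢ≢i i₀ i))) ⟩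
    g i₀ + 0#                      ≈⟨ +-identityʳ (g i₀) ⟩
    g i₀                           ∎

  Binary : ∀ {k} → (Fin k → Carrier) → Set ℓ₁
  Binary g = ∀ i → g i ≈ 0# ⊎ g i ≈ 1#

  UnitAt : ∀ {k} → (Fin k → Carrier) → Fin k → Set ℓ₁
  UnitAt g i₀ = g i₀ ≈ 1# × (∀ i → i ≢ i₀ → g i ≈ 0#)

  ∑-unit : ∀ {k} {g : Fin k → Carrier} {i₀} → UnitAt g i₀ → ∑ g ≈ 1#
  ∑-unit {i₀ = i₀} (g≈1 , g≈0) = trans (∑-single i₀ g≈0) g≈1

  unit-unique : ∀ {k} {g : Fin k → Carrier} {i₀ j} → UnitAt g i₀ → g j ≈ 1# → j ≡ i₀
  unit-unique {i₀ = i₀} {j} (_ , g≈0) gj≈1 with j ≟ i₀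
  ... | yes j≡i₀ = j≡i₀
  ... | no j≢i₀ = ⊥-elim (0≉1 (trans (sym (g≈0 j j≢i₀)) gj≈1))

  data Shape {k} (g : Fin k → Carrier) : Set (c ⊔ ℓ₁ ⊔ ℓ₂) where
    zeros   : (∀ i → g i ≈ 0#) → Shape g
    unit    : ∀ i₀ → UnitAt g i₀ → Shape g
    several : ∀ {j l e} → j ≢ l → g j ≈ 1# → g l ≈ 1# →
              0# ≤F e → ∑ g ≈ 1# + (1# + e) → Shape g

  shape : ∀ {k} {g : Fin k → Carrier} → Binary g → Shape g
  shape {ℕ.zero} _ = zeros (λ ())
  shape {ℕ.suc _} {g} binary = cons (binary zero) (shape (binary ∘ suc))
    where
    cons : g zero ≈ 0# ⊎ g zero ≈ 1# → Shape (g ∘ suc) → Shape g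
    cons (inj₁ g₀≈0) (zeros g≈0) = zeros λ { zero → g₀≈0 ; (suc i) → g≈0 i }
    cons (inj₂ g₀≈1) (zeros g≈0) =
      unit zero (g₀≈1 , λ { zero 0≢0 → ⊥-elim (0≢0 ≡.refl) ; (suc i) _ → g≈0 i })
    cons (inj₁ g₀≈0) (unit i₀ (g≈1 , g≈0)) =
      unit (suc i₀) (g≈1 , λ { zero _ → g₀≈0 ; (suc i) i≢i₀ → g≈0 i (i≢i₀ ∘ ≡.cong suc) })
    cons (inj₂ g₀≈1) (unit i₀ u) =
      several (λ ()) g₀≈1 (proj₁ u) ≤.refl
        (+-cong g₀≈1 (trans (∑-unit u) (sym (+-identityʳ 1#))))
    cons (inj₁ g₀≈0) (several j≢l gj≈1 gl≈1 0≤e sum≈) =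
      several (j≢l ∘ suc-injective) gj≈1 gl≈1 0≤e
        (trans (+-cong g₀≈0 sum≈) (+-identityˡ _))
    cons (inj₂ g₀≈1) (several j≢l gj≈1 gl≈1 0≤e sum≈) =
      several (j≢l ∘ suc-injective) gj≈1 gl≈1 (+-nonneg 0≤1 0≤e) (+-cong g₀≈1 sum≈)

  binary-∑∈01⇒zeros⊎unit : ∀ {k} {g : Fin k → Carrier} → Binary g →
    ∑ g ≈ 0# ⊎ ∑ g ≈ 1# → (∀ i → g i ≈ 0#) ⊎ Σ (Fin k) (UnitAt g)
  binary-∑∈01⇒zeros⊎unit binary ∑∈01 with shape binary
  ... | zeros g≈0 = inj₁ g≈0
  ... | unit i₀ u = inj₂ (i₀ , u)
  ... | several _ _ _ 0≤e sum≈ =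
    ⊥-elim (2+x∉01 0≤e (Sum.map (trans (sym sum≈)) (trans (sym sum≈)) ∑∈01))

  two-ones⇒∑∉01 : ∀ {k} {g : Fin k → Carrier} {j l} → Binary g → j ≢ l →
    g j ≈ 1# → g l ≈ 1# → ¬ (∑ g ≈ 0# ⊎ ∑ g ≈ 1#)
  two-ones⇒∑∉01 binary j≢l gj≈1 gl≈1 ∑∈01 with binary-∑∈01⇒zeros⊎unit binary ∑∈01
  ... | inj₁ g≈0 = 0≉1 (trans (sym (g≈0 _)) gj≈1)
  ... | inj₂ (_ , u) = j≢l (≡.trans (unit-unique u gj≈1) (≡.sym (unit-unique u gl≈1)))

  at-most-one-one⇒∑∈01 : ∀ {k} {g : Fin k → Carrier} → Binary g →
    (∀ {j l} → g j ≈ 1# → g l ≈ 1# → j ≡ l) → ∑ g ≈ 0# ⊎ ∑ g ≈ 1#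
  at-most-one-one⇒∑∈01 binary one-one with shape binary
  ... | zeros g≈0 = inj₁ (∑-zeros g≈0)
  ... | unit _ u = inj₂ (∑-unit u)
  ... | several j≢l gj≈1 gl≈1 _ _ = ⊥-elim (j≢l (one-one gj≈1 gl≈1))

  module _ {m : ℕ} (z : Fin m → Carrier) where

    _·_ : (Fin m → Carrier) → (Fin m → Carrier) → Carrier
    u · g = ∑ (λ i → u i * g i)

    ·-zeros : ∀ {g} → (∀ i → g i ≈ 0#) → z · g ≈ 0#
    ·-zeros g≈0 = ∑-zeros (λ i → trans (*-congˡ (g≈0 i)) (zeroʳ (z i)))

    ·-unit : ∀ {g i₀} → UnitAt g i₀ → z · g ≈ z i₀
    ·-unit {i₀ = i₀} (g≈1 , g≈0) =
      trans (∑-single i₀ (λ i i≢i₀ → trans (*-congˡ (g≈0 i i≢i₀)) (zeroʳ (z i))))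
            (trans (*-congˡ g≈1) (*-identityʳ (z i₀)))

    module _ {n : ℕ} where

      φ-cong : ∀ {X Y : Matrix m n} → (∀ ij → X ij ≈ Y ij) → ∀ j → φ z X j ≈ φ z Y j
      φ-cong X≈Y j = sum-cong-≋ (λ i → *-congˡ (X≈Y (i , j)))

      φ-∑ : ∀ {k} (w : Fin k → Carrier) (P : Fin k → Matrix m n) j →
        φ z (λ ij → ∑ (λ t → w t * P t ij)) j ≈ ∑ (λ t → w t * φ z (P t) j)
      φ-∑ w P j = begin
        ∑ (λ i → z i * ∑ (λ t → w t * P t (i , j)))
          ≈⟨ sum-cong-≋ (λ i → *-distribˡ-sum (z i) (λ t → w t * P t (i , j))) ⟩
        ∑ (λ i → ∑ (λ t → z i * (w t * P t (i , j))))
          ≈⟨ ∑-comm (λ i t → z i * (w t * P t (i , j))) ⟩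
        ∑ (λ t → ∑ (λ i → z i * (w t * P t (i , j))))
          ≈⟨ sum-cong-≋ (λ t → sum-cong-≋ (λ i → x*[y*q]≈y*[x*q] (z i) (w t) _)) ⟩
        ∑ (λ t → ∑ (λ i → w t * (z i * P t (i , j))))
          ≈⟨ sum-cong-≋ (λ t → sym (*-distribˡ-sum (w t) (λ i → z i * P t (i , j)))) ⟩
        ∑ (λ t → w t * φ z (P t) j)
          ∎
        where
        x*[y*q]≈y*[x*q] : ∀ x y q → x * (y * q) ≈ y * (x * q)
        x*[y*q]≈y*[x*q] x y q =
          trans (sym (*-assoc x y q)) (trans (*-congʳ (*-comm x y)) (*-assoc y x q))

      image-conv⊆conv-image : ∀ {p q} (S : Matrix m n → Set p) (T : (Fin n → Carrier) → Set q) →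
        (∀ {X} → S X → T (φ z X)) → ∀ {y} → Image z (conv S) y → conv T y
      image-conv⊆conv-image _ _ S⇒T (X , (k , P , w , P∈S , w≥0 , ∑w≈1 , X≈) , y≈) =
        k , (λ t → φ z (P t)) , w , (λ t → S⇒T (P∈S t)) , w≥0 , ∑w≈1 ,
        λ j → trans (y≈ j) (trans (φ-cong X≈ j) (φ-∑ w P j))

      conv-image⊆image-conv : ∀ {p q} (S : Matrix m n → Set p) (T : (Fin n → Carrier) → Set q) →
        (∀ {v} → T v → Image z S v) → ∀ {y} → conv T y → Image z (conv S) y
      conv-image⊆image-conv _ _ T⇒imS (k , v , w , v∈T , w≥0 , ∑w≈1 , y≈) =
        (λ ij → ∑ (λ t → w t * P t ij)) ,
        (k , P , w , (λ t → proj₁ (proj₂ (T⇒imS (v∈T t)))) , w≥0 , ∑w≈1 , (λ _ → refl)) ,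
        λ j → trans (y≈ j)
          (trans (sum-cong-≋ (λ t → *-congˡ (proj₂ (proj₂ (T⇒imS (v∈T t))) j)))
                 (sym (φ-∑ w P j)))
        where
        P : Fin k → Matrix m n
        P t = proj₁ (T⇒imS (v∈T t))

      column-zeros⊎unit : ∀ {X : Matrix m n} → IsPartialPerm X → ∀ j →
        (∀ i → X (i , j) ≈ 0#) ⊎ Σ (Fin m) (UnitAt (λ i → X (i , j)))
      column-zeros⊎unit (entries , _ , columns) j =
        binary-∑∈01⇒zeros⊎unit (λ i → entries (i , j)) (columns j)

      partialPerm⇒word : (∀ i j → i ≢ j → ¬ (z i ≈ z j)) →
        ∀ {X : Matrix m n} → IsPartialPerm X → IsWord n z (φ z X)
      partialPerm⇒word z-injective {X} pp@(entries , rows , _) = letter , distinct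
        where
        letter : ∀ j → φ z X j ≈ 0# ⊎ Σ (Fin m) (λ i → φ z X j ≈ z i)
        letter j with column-zeros⊎unit pp j
        ... | inj₁ col≈0 = inj₁ (·-zeros col≈0)
        ... | inj₂ (i₀ , u) = inj₂ (i₀ , ·-unit u)

        distinct : ∀ j k → j ≢ k → ¬ (φ z X j ≈ 0#) → ¬ (φ z X j ≈ φ z X k)
        distinct j k j≢k φj≉0 φj≈φk with column-zeros⊎unit pp j | column-zeros⊎unit pp k
        ... | inj₁ colj≈0 | _ = φj≉0 (·-zeros colj≈0)
        ... | inj₂ _ | inj₁ colk≈0 = φj≉0 (trans φj≈φk (·-zeros colk≈0))
        ... | inj₂ (i₀ , uj) | inj₂ (i₁ , uk) with i₀ ≟ i₁
        ... | no i₀≢i₁ =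
          z-injective i₀ i₁ i₀≢i₁ (trans (sym (·-unit uj)) (trans φj≈φk (·-unit uk)))
        ... | yes ≡.refl =
          two-ones⇒∑∉01 (λ l → entries (i₀ , l)) j≢k (proj₁ uj) (proj₁ uk) (rows i₀)

    δ : Fin m → Fin m → Carrier
    δ i₀ i with i ≟ i₀
    ... | yes _ = 1#
    ... | no _ = 0#

    δ-unit : ∀ i₀ → UnitAt (δ i₀) i₀
    δ-unit i₀ = δi₀i₀≈1 , δi₀i≈0
      where
      δi₀i₀≈1 : δ i₀ i₀ ≈ 1#
      δi₀i₀≈1 with i₀ ≟ i₀
      ... | yes _ = refl
      ... | no i₀≢i₀ = ⊥-elim (i₀≢i₀ ≡.refl)
      δi₀i≈0 : ∀ i → i ≢ i₀ → δ i₀ i ≈ 0#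
      δi₀i≈0 i i≢i₀ with i ≟ i₀
      ... | yes i≡i₀ = ⊥-elim (i≢i₀ i≡i₀)
      ... | no _ = refl

    δ-binary : ∀ i₀ → Binary (δ i₀)
    δ-binary i₀ i with i ≟ i₀
    ... | yes _ = inj₂ refl
    ... | no _ = inj₁ refl

    Letter : Carrier → Set ℓ₁
    Letter x = x ≈ 0# ⊎ Σ (Fin m) (λ i → x ≈ z i)

    letterColumn : ∀ {x} → Letter x → Fin m → Carrier
    letterColumn (inj₁ _) _ = 0#
    letterColumn (inj₂ (i₀ , _)) = δ i₀

    letterColumn-binary : ∀ {x} (a : Letter x) → Binary (letterColumn a)
    letterColumn-binary (inj₁ _) _ = inj₁ refl
    letterColumn-binary (inj₂ (i₀ , _)) = δ-binary i₀

    letterColumn-∑∈01 : ∀ {x} (a : Letter x) →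
      ∑ (letterColumn a) ≈ 0# ⊎ ∑ (letterColumn a) ≈ 1#
    letterColumn-∑∈01 (inj₁ _) = inj₁ (∑-zeros {m} (λ _ → refl))
    letterColumn-∑∈01 (inj₂ (i₀ , _)) = inj₂ (∑-unit (δ-unit i₀))

    letterColumn-· : ∀ {x} (a : Letter x) → x ≈ z · letterColumn a
    letterColumn-· (inj₁ x≈0) = trans x≈0 (sym (·-zeros {g = λ _ → 0#} (λ _ → refl)))
    letterColumn-· (inj₂ (i₀ , x≈zi₀)) = trans x≈zi₀ (sym (·-unit (δ-unit i₀)))

    letterColumn-one : ∀ {x} (a : Letter x) {i} → letterColumn a i ≈ 1# → x ≈ z i
    letterColumn-one (inj₁ _) 0≈1 = ⊥-elim (0≉1 0≈1)
    letterColumn-one (inj₂ (i₀ , x≈zi₀)) {i} δi₀i≈1 with unit-unique {j = i} (δ-unit i₀) δi₀i≈1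
    ... | ≡.refl = x≈zi₀

    word⇒image : (∀ i → ¬ (z i ≈ 0#)) →
      ∀ {n} {v : Fin n → Carrier} → IsWord n z v → Image z IsPartialPerm v
    word⇒image z≉0 {n} {v} (letter , distinct) = X , (entries , rows , columns) , v≈φX
      where
      X : Matrix m n
      X (i , j) = letterColumn (letter j) i

      entries : ∀ ij → X ij ≈ 0# ⊎ X ij ≈ 1#
      entries (i , j) = letterColumn-binary (letter j) i

      columns : ∀ j → colSum X j ≈ 0# ⊎ colSum X j ≈ 1#
      columns j = letterColumn-∑∈01 (letter j)

      rows : ∀ i → rowSum X i ≈ 0# ⊎ rowSum X i ≈ 1#
      rows i = at-most-one-one⇒∑∈01 (λ j → entries (i , j)) one-one
        where
        one-one : ∀ {j k} → X (i , j) ≈ 1# → X (i , k) ≈ 1# → j ≡ k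
        one-one {j} {k} Xij≈1 Xik≈1 with j ≟ k
        ... | yes j≡k = j≡k
        ... | no j≢k = ⊥-elim (distinct j k j≢k (z≉0 i ∘ trans (sym vj≈zi))
                                 (trans vj≈zi (sym (letterColumn-one (letter k) Xik≈1))))
          where
          vj≈zi : v j ≈ z i
          vj≈zi = letterColumn-one (letter j) Xij≈1

      v≈φX : ∀ j → v j ≈ φ z X j
      v≈φX j = letterColumn-· (letter j)

theorem5p25 : ∀ {c ℓ₁ ℓ₂} (F : OrderedField c ℓ₁ ℓ₂) (m n : ℕ) → 1 ≤ m → 1 ≤ n →
    (z : Fin m → OrderedField.Carrier F) →
    (∀ i → ¬ OrderedField._≈_ F (z i) (OrderedField.0# F)) →
    (∀ i j → i ≢ j → ¬ OrderedField._≈_ F (z i) (z j)) →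
    ∀ y → (Poly.Image F z (Poly.PPerm F m n) y → Poly.𝒫 F z n y)
        × (Poly.𝒫 F z n y → Poly.Image F z (Poly.PPerm F m n) y)
theorem5p25 F m n _ _ z z≉0 z-injective y =
    image-conv⊆conv-image z IsPartialPerm (IsWord n z) (partialPerm⇒word z z-injective)
  , conv-image⊆image-conv z IsPartialPerm (IsWord n z) (word⇒image z z≉0)
  where open PartialPermutations F
        open Poly F using (IsPartialPerm; IsWord)
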